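{- For all positive integers $n$ and $k$, the number of permutations of length $n$ that are sortable with at most $k$ passes through the stack (i.e., the permutations of length $n$ of tier at most $k-1$) is $\sum_{j=0}^{k-1}T(n,j)$.
   Context: Multi-pass stack sorting: in a pass, the entries of the current input are pushed one at a time, in order, onto a stack; whenever the top of the stack is the smallest value not yet output, it is popped to the output (repeatedly); entries are never popped otherwise. When all input entries have been pushed and no pop is possible, if the stack is nonempty the remaining entries are returned to the input in their original relative order and a new pass begins. The tier of a permutation is one less than the minimum number of passes needed to output $1,\dots,n$. $T(n,t)$ is the number of integer sequences $a_na_{n-1}\cdots a_1$ with $1\le a_j\le n-j+1$ for all $j$ having exactly $t$ indices $i\in\{1,\dots,n-1\}$ with $a_{i+1}>a_i$. -}

module Defs where

open import Data.Nat using (ℕ; zero; suc; _+_; _∸_; _≡ᵇ_; _<ᵇ_; _≤ᵇ_)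
open import Data.Bool using (Bool; true; false; if_then_else_; _∧_)
open import Data.List using (List; []; _∷_; map; concatMap; upTo; filterᵇ; length; reverse)
open import Data.Bool.ListAction using (all; any)
open import Data.Product using (_×_; _,_; proj₁; proj₂)
open import Function using (_∘_)

range1 : ℕ → List ℕ
range1 b = map suc (upTo b)

seqs : ℕ → ℕ → List (List ℕ)
seqs zero    b = [] ∷ []
seqs (suc n) b = concatMap (λ x → map (x ∷_) (seqs n b)) (range1 b)

-- A sequence of length n over {1..n} is a permutation of [n] iff every value 1..n occurs
containsAll : ℕ → List ℕ → Bool
containsAll n l = all (λ v → any (v ≡ᵇ_) l) (range1 n)

perms : ℕ → List (List ℕ)
perms n = filterᵇ (containsAll n) (seqs n n)

-- Multi-pass stack sorting.
-- State: m = smallest value not yet output (outputs are always 1,2,3,... in order).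
-- The stack is a list with its TOP as the head.

popWhile : ℕ → List ℕ → ℕ × List ℕ
popWhile m []       = m , []
popWhile m (y ∷ ys) = if y ≡ᵇ m then popWhile (suc m) ys else (m , y ∷ ys)

pushAll : ℕ → List ℕ → List ℕ → ℕ × List ℕ
pushAll m st []       = m , st
pushAll m st (x ∷ xs) with popWhile m (x ∷ st)
... | m' , st' = pushAll m' st' xs

-- One pass: run the input through an empty stack; the entries remaining on the
-- stack are returned to the input in their original relative order
-- (bottom-to-top order of the stack = reverse of the top-first list).
pass : ℕ × List ℕ → ℕ × List ℕ
pass (m , inp) with pushAll m [] inp
... | m' , st = m' , reverse st

passes : ℕ → ℕ × List ℕ → ℕ × List ℕ
passes zero    s = s
passes (suc k) s = passes k (pass s)

-- π is sortable with at most k passes (i.e. tier(π) ≤ k - 1): after k passes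
-- starting with smallest-not-yet-output value 1, the input is exhausted.
sortableIn : ℕ → List ℕ → Bool
sortableIn k π with proj₂ (passes k (1 , π))
... | []    = true
... | _ ∷ _ = false

numSortable : ℕ → ℕ → ℕ
numSortable n k = length (filterᵇ (sortableIn k) (perms n))

-- T(n,t).  A sequence a_n a_{n-1} ... a_1 is represented by the list
-- [a_1 , a_2 , ... , a_n]  (index j at position j - 1).

-- entry at position p (i.e. a_{p+1}) satisfies 1 ≤ a ≤ b, where b starts at n and
-- decreases by one per position: a_j ≤ n - j + 1.
boundedFrom : ℕ → List ℕ → Bool
boundedFrom b []       = true
boundedFrom b (x ∷ xs) = (1 ≤ᵇ x) ∧ (x ≤ᵇ b) ∧ boundedFrom (b ∸ 1) xs

-- number of i with a_{i+1} > a_i, for the list [a_1 , ... , a_n]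
ascents : List ℕ → ℕ
ascents (x ∷ y ∷ xs) = (if x <ᵇ y then 1 else 0) + ascents (y ∷ xs)
ascents _            = 0

T : ℕ → ℕ → ℕ
T n t = length (filterᵇ (λ a → boundedFrom n a ∧ (ascents a ≡ᵇ t)) (seqs n n))

-- Encode a sequence a₁ a₂ ⋯ aₙ with 1 ≤ aⱼ ≤ n − j + 1 by inserting 1, with exactly a₁ − 1
-- entries after it, into the permutation encoded by a₂ ⋯ aₙ with all its values raised by one;
-- this is a bijection onto the permutations of length n.
-- In the first pass 1 is popped as soon as it is pushed.  If 1 comes before 2, or right after
-- it, then 2 is popped in the same pass and the pass acts exactly as on the input with 1
-- deleted.  Otherwise 2 is buried under the entry following it, nothing else is popped, and
-- the pass hands back the input with 1 deleted, costing one whole pass.  The second case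
-- occurs exactly when a₁ < a₂, so the encoded permutation needs one pass more than the number
-- of ascents of the sequence, and counting sequences by their number of ascents gives the sum.
module Submission where

open import Defs
open import Data.Nat using (ℕ; _≤_)
open import Data.List using (map; upTo)
open import Data.Nat.ListAction using (sum)
open import Relation.Binary.PropositionalEquality using (_≡_)

open import Data.Bool using (Bool; true; false; _∧_; _∨_) renaming (T to IsTrue; T? to IsTrue?)
open import Data.Bool.Properties using (T-∧)
open import Data.Empty using (⊥-elim)
open import Data.List
  using (List; []; _∷_; _++_; [_]; _ʳ++_; reverse; null; length; concatMap; cartesianProductWith; filterᵇ)
open import Data.List.Properties
  using ( ∷-injective; map-injective; map-++; map-∘; map-id-local; map-cong; length-map; length-++
        ; length-++-≤ˡ; length-upTo; upTo-∷ʳ; ++-assoc; ++-ʳ++; reverse-involutive; reverse-map )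
open import Data.List.Membership.Propositional using (_∈_)
open import Data.List.Membership.Propositional.Properties
  using ( ∈-map⁺; ∈-map⁻; ∈-upTo⁺; ∈-upTo⁻; ∈-cartesianProductWith⁺; ∈-cartesianProductWith⁻
        ; ∈-filter⁺; ∈-filter⁻; ∈-∃++ )
open import Data.List.Membership.Propositional.Properties.WithK using (unique∧set⇒bag)
open import Data.List.Relation.Binary.BagAndSetEquality using (∼bag⇒↭)
open import Data.List.Relation.Binary.Permutation.Propositional using (_↭_)
open import Data.List.Relation.Binary.Permutation.Propositional.Properties
  using (∈-resp-↭; ↭-length; filter-↭) renaming (shift to ↭-shift)
open import Data.List.Relation.Binary.Subset.Propositional using (_⊆_)
open import Data.List.Relation.Unary.All using (All; []; _∷_)
import Data.List.Relation.Unary.All as All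
import Data.List.Relation.Unary.All.Properties as All
open import Data.List.Relation.Unary.All.Properties using (++⁺; ++⁻ˡ; ++⁻ʳ)
import Data.List.Relation.Unary.AllPairs as AllPairs
open import Data.List.Relation.Unary.Any using (here; there)
import Data.List.Relation.Unary.Any as Any
import Data.List.Relation.Unary.Any.Properties as Any
open import Data.List.Relation.Unary.Unique.Propositional using (Unique)
import Data.List.Relation.Unary.Unique.Propositional.Properties as Unique
open import Data.Nat using (zero; suc; pred; _+_; _∸_; _<_; _<ᵇ_; _≡ᵇ_; _≟_; _≤?_; z≤n; s≤s)
open import Data.Nat.ListAction.Properties using (sum-++)
open import Data.Nat.Properties
  using ( suc-injective; ≡⇒≡ᵇ; ≡ᵇ⇒≡; ≤ᵇ⇒≤; ≤⇒≤ᵇ; <⇒<ᵇ; <ᵇ⇒<; >⇒≢; n<1+n; 1+n≰n; ≮⇒≥; ≰⇒>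
        ; <-trans; ≤-trans; ≤-antisym; ≤-reflexive; ≤-pred; m≤n⇒m≤1+n; m≤n⇒∃[o]m+o≡n
        ; +-comm; +-suc; +-identityʳ; +-cancelˡ-≤; +-∸-assoc; m∸n≤m; ∸-monoʳ-≤; ∸-cancelˡ-≡; m∸[m∸n]≡n )
open import Data.Product using (_×_; _,_; ∃; ∃₂; proj₁; proj₂; uncurry; map₂)
open import Function using (_∘_)
open import Function.Bundles using (Equivalence; mk⇔)
open import Relation.Binary.PropositionalEquality
  using (_≢_; refl; sym; trans; cong; cong₂; subst; module ≡-Reasoning)
open import Relation.Nullary using (yes; no)
open import Relation.Nullary.Decidable using (dec-true; dec-false)

open ≡-Reasoning

insert : {A : Set} → ℕ → A → List A → List A
insert zero    x ys       = x ∷ ys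
insert (suc i) x []       = x ∷ []
insert (suc i) x (y ∷ ys) = y ∷ insert i x ys

module _ {A : Set} where

  length-insert : ∀ i (x : A) ys → length (insert i x ys) ≡ suc (length ys)
  length-insert zero    x ys       = refl
  length-insert (suc i) x []       = refl
  length-insert (suc i) x (y ∷ ys) = cong suc (length-insert i x ys)

  null-insert : ∀ i (x : A) ys → null (insert i x ys) ≡ false
  null-insert zero    x ys      = refl
  null-insert (suc i) x []      = refl
  null-insert (suc i) x (_ ∷ _) = refl

  null-++-∷ : ∀ xs (x : A) ys → null (xs ++ x ∷ ys) ≡ false
  null-++-∷ []      x ys = refl
  null-++-∷ (_ ∷ _) x ys = refl

  insert-length : ∀ (x : A) P Q → insert (length P) x (P ++ Q) ≡ P ++ x ∷ Q
  insert-length x []      Q = refl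
  insert-length x (p ∷ P) Q = cong (p ∷_) (insert-length x P Q)

  insert-++ʳ : ∀ i (x : A) P Q → insert (length P + i) x (P ++ Q) ≡ P ++ insert i x Q
  insert-++ʳ i x []      Q = refl
  insert-++ʳ i x (p ∷ P) Q = cong (p ∷_) (insert-++ʳ i x P Q)

  insert-++ˡ : ∀ {i} (x : A) P Q → i ≤ length P → insert i x (P ++ Q) ≡ insert i x P ++ Q
  insert-++ˡ {zero}  x P       Q _        = refl
  insert-++ˡ {suc i} x (p ∷ P) Q (s≤s i≤) = cong (p ∷_) (insert-++ˡ x P Q i≤)

  insert-split : ∀ {i} (x : A) ys → i ≤ length ys →
                 ∃₂ λ P Q → ys ≡ P ++ Q × length P ≡ i × insert i x ys ≡ P ++ x ∷ Q
  insert-split {zero}  x ys       _        = [] , ys , refl , refl , refl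
  insert-split {suc i} x (y ∷ ys) (s≤s i≤) with insert-split x ys i≤
  ... | P , Q , refl , refl , eq = y ∷ P , Q , refl , refl , cong (y ∷_) eq

  All-insert : ∀ {P : A → Set} i x ys → P x → All P ys → All P (insert i x ys)
  All-insert zero    x ys       px ys-P        = px ∷ ys-P
  All-insert (suc i) x []       px []          = px ∷ []
  All-insert (suc i) x (y ∷ ys) px (py ∷ ys-P) = py ∷ All-insert i x ys px ys-P

  ∈-insert : ∀ i (x : A) ys → x ∈ insert i x ys
  ∈-insert zero    x ys       = here refl
  ∈-insert (suc i) x []       = here refl
  ∈-insert (suc i) x (y ∷ ys) = there (∈-insert i x ys)

  ∈-insert⁺ : ∀ {v} i (x : A) ys → v ∈ ys → v ∈ insert i x ys
  ∈-insert⁺ zero    x ys       v∈         = there v∈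
  ∈-insert⁺ (suc i) x (y ∷ ys) (here v≡y) = here v≡y
  ∈-insert⁺ (suc i) x (y ∷ ys) (there v∈) = there (∈-insert⁺ i x ys v∈)

  insert-injective : ∀ {x : A} i j (ys zs : List A) → All (_≢ x) ys → All (_≢ x) zs →
                     i ≤ length ys → j ≤ length zs → insert i x ys ≡ insert j x zs → i ≡ j × ys ≡ zs
  insert-injective zero    zero    ys       zs       _          _          _       _       eq =
    refl , proj₂ (∷-injective eq)
  insert-injective zero    (suc j) ys       (z ∷ zs) _          (z≢x ∷ _)  _       _       eq =
    ⊥-elim (z≢x (sym (proj₁ (∷-injective eq))))
  insert-injective (suc i) zero    (y ∷ ys) zs       (y≢x ∷ _)  _          _       _       eq =
    ⊥-elim (y≢x (proj₁ (∷-injective eq)))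
  insert-injective (suc i) (suc j) (y ∷ ys) (z ∷ zs) (_ ∷ ys≢x) (_ ∷ zs≢x) (s≤s i≤) (s≤s j≤) eq
    with refl , eq′ ← ∷-injective eq
    with refl , refl ← insert-injective i j ys zs ys≢x zs≢x i≤ j≤ eq′ = refl , refl

  unique∧⊆∧length≤⇒⊇ : ∀ {U L : List A} → Unique U → U ⊆ L → length L ≤ length U → L ⊆ U
  unique∧⊆∧length≤⇒⊇ {[]}    {[]} _ _ _ ()
  unique∧⊆∧length≤⇒⊇ {u ∷ U} {L}  (u∉U AllPairs.∷ unique-U) U⊆L L≤U z∈L
    with L₁ , L₂ , refl ← ∈-∃++ (U⊆L (here refl))
    with ∈-resp-↭ (↭-shift u L₁ L₂) z∈L
  ... | here z≡u   = here z≡u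
  ... | there z∈L′ = there (unique∧⊆∧length≤⇒⊇ unique-U U⊆L′ L′≤U z∈L′)
    where
    U⊆L′ : U ⊆ L₁ ++ L₂
    U⊆L′ w∈U with ∈-resp-↭ (↭-shift u L₁ L₂) (U⊆L (there w∈U))
    ... | here refl  = ⊥-elim (All.lookup u∉U w∈U refl)
    ... | there w∈L′ = w∈L′
    L′≤U : length (L₁ ++ L₂) ≤ length U
    L′≤U = ≤-pred (subst (_≤ suc (length U)) (↭-length (↭-shift u L₁ L₂)) L≤U)

  map-unique : ∀ {B : Set} {f : A → B} {xs} → (∀ {x y} → x ∈ xs → y ∈ xs → f x ≡ f y → x ≡ y) →
               Unique xs → Unique (map f xs)
  map-unique {xs = []}    _   _                        = AllPairs.[]
  map-unique {xs = x ∷ _} inj (x∉xs AllPairs.∷ unique) =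
    All.map⁺ (All.tabulate λ y∈ fx≡fy → All.lookup x∉xs y∈ (inj (here refl) (there y∈) fx≡fy))
    AllPairs.∷ map-unique (λ x∈ y∈ → inj (there x∈) (there y∈)) unique

All>⇒≢ : ∀ {m xs} → All (m <_) xs → All (_≢ m) xs
All>⇒≢ = All.map >⇒≢

All>suc⇒≢ : ∀ {m xs} → All (suc m <_) xs → All (_≢ m) xs
All>suc⇒≢ = All.map (>⇒≢ ∘ <-trans (n<1+n _))

map-suc-above : ∀ {m} xs → All (m <_) xs → All (suc m <_) (map suc xs)
map-suc-above xs xs>m = All.map⁺ (All.map s≤s xs>m)

-- One pass of the stack

popWhile-min : ∀ m st → popWhile m (m ∷ st) ≡ popWhile (suc m) st
popWhile-min m st rewrite dec-true (m ≟ m) refl = refl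

popWhile-blocked : ∀ {m x} st → x ≢ m → popWhile m (x ∷ st) ≡ (m , x ∷ st)
popWhile-blocked {m} {x} st x≢m rewrite dec-false (x ≟ m) x≢m = refl

popWhile-ʳ++ : ∀ {m} A st → All (_≢ m) A → popWhile m st ≡ (m , st) →
               popWhile m (A ʳ++ st) ≡ (m , A ʳ++ st)
popWhile-ʳ++ []      st []          blocked = blocked
popWhile-ʳ++ (x ∷ A) st (x≢m ∷ A≢m) blocked = popWhile-ʳ++ A (x ∷ st) A≢m (popWhile-blocked st x≢m)

pushAll-++ : ∀ m st xs ys → pushAll m st (xs ++ ys) ≡ uncurry pushAll (pushAll m st xs) ys
pushAll-++ m st []       ys = refl
pushAll-++ m st (x ∷ xs) ys with popWhile m (x ∷ st)
... | m′ , st′ = pushAll-++ m′ st′ xs ys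

pushAll-avoiding : ∀ {m} st xs → All (_≢ m) xs → pushAll m st xs ≡ (m , xs ʳ++ st)
pushAll-avoiding st []       []           = refl
pushAll-avoiding st (x ∷ xs) (x≢m ∷ xs≢m) rewrite popWhile-blocked st x≢m = pushAll-avoiding (x ∷ st) xs xs≢m

pushAll-through : ∀ {m} st A ys → All (_≢ m) A → pushAll m st (A ++ ys) ≡ pushAll m (A ʳ++ st) ys
pushAll-through {m} st A ys A≢m =
  trans (pushAll-++ m st A ys) (cong (λ s → uncurry pushAll s ys) (pushAll-avoiding st A A≢m))

pushAll-min : ∀ m st ys → pushAll m st (m ∷ ys) ≡ uncurry pushAll (popWhile (suc m) st) ys
pushAll-min m st ys rewrite popWhile-min m st = refl

pass-pushAll : ∀ m xs → pass (m , xs) ≡ map₂ reverse (pushAll m [] xs)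
pass-pushAll m xs with pushAll m [] xs
... | _ = refl

pass-cong : ∀ m xs m′ ys → pushAll m [] xs ≡ pushAll m′ [] ys → pass (m , xs) ≡ pass (m′ , ys)
pass-cong m xs m′ ys eq = begin
  pass (m , xs)                    ≡⟨ pass-pushAll m xs ⟩
  map₂ reverse (pushAll m [] xs)   ≡⟨ cong (map₂ reverse) eq ⟩
  map₂ reverse (pushAll m′ [] ys)  ≡⟨ pass-pushAll m′ ys ⟨
  pass (m′ , ys)                   ∎

pass-remove-min : ∀ {m} A B → All (suc m <_) A → pass (m , A ++ m ∷ B) ≡ pass (suc m , A ++ B)
pass-remove-min {m} A B A>m+1 = pass-cong m (A ++ m ∷ B) (suc m) (A ++ B) (begin
  pushAll m [] (A ++ m ∷ B)                        ≡⟨ pushAll-through [] A (m ∷ B) (All>suc⇒≢ A>m+1) ⟩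
  pushAll m (A ʳ++ []) (m ∷ B)                     ≡⟨ pushAll-min m (A ʳ++ []) B ⟩
  uncurry pushAll (popWhile (suc m) (A ʳ++ [])) B
    ≡⟨ cong (λ s → uncurry pushAll s B) (popWhile-ʳ++ A [] (All>⇒≢ A>m+1) refl) ⟩
  pushAll (suc m) (A ʳ++ []) B                     ≡⟨ pushAll-through [] A B (All>⇒≢ A>m+1) ⟨
  pushAll (suc m) [] (A ++ B)                      ∎)

pass-remove-min-after-next : ∀ {m} A B → All (suc m <_) A →
                             pass (m , A ++ suc m ∷ m ∷ B) ≡ pass (suc m , A ++ suc m ∷ B)
pass-remove-min-after-next {m} A B A>m+1 = pass-cong m (A ++ suc m ∷ m ∷ B) (suc m) (A ++ suc m ∷ B) (begin
  pushAll m [] (A ++ suc m ∷ m ∷ B)                        ≡⟨ pushAll-through [] A _ (All>suc⇒≢ A>m+1) ⟩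
  pushAll m (A ʳ++ []) (suc m ∷ m ∷ B)                     ≡⟨ pushAll-through _ [ suc m ] (m ∷ B) (>⇒≢ (n<1+n m) ∷ []) ⟩
  pushAll m (suc m ∷ A ʳ++ []) (m ∷ B)                     ≡⟨ pushAll-min m _ B ⟩
  uncurry pushAll (popWhile (suc m) (suc m ∷ A ʳ++ [])) B  ≡⟨ cong (λ s → uncurry pushAll s B) (popWhile-min (suc m) _) ⟩
  uncurry pushAll (popWhile (suc (suc m)) (A ʳ++ [])) B    ≡⟨ pushAll-min (suc m) (A ʳ++ []) B ⟨
  pushAll (suc m) (A ʳ++ []) (suc m ∷ B)                   ≡⟨ pushAll-through [] A _ (All>⇒≢ A>m+1) ⟨
  pushAll (suc m) [] (A ++ suc m ∷ B)                      ∎)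

pass-next-buried : ∀ {m} C z D B → All (suc m <_) C → All (suc m <_) (z ∷ D) → All (suc m <_) B →
                   pass (m , C ++ suc m ∷ z ∷ D ++ m ∷ B) ≡ (suc m , C ++ suc m ∷ z ∷ D ++ B)
pass-next-buried {m} C z D B C>m+1 zD>m+1@(z>m+1 ∷ D>m+1) B>m+1 = begin
  pass (m , C ++ suc m ∷ z ∷ D ++ m ∷ B)                      ≡⟨ pass-pushAll m (C ++ suc m ∷ z ∷ D ++ m ∷ B) ⟩
  map₂ reverse (pushAll m [] (C ++ suc m ∷ z ∷ D ++ m ∷ B))  ≡⟨ cong (map₂ reverse) stack ⟩
  (suc m , reverse (B ʳ++ E ʳ++ []))                          ≡⟨ cong (suc m ,_) unwind ⟩
  (suc m , C ++ suc m ∷ z ∷ D ++ B)                           ∎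
  where
  E = C ++ suc m ∷ z ∷ D

  buried : popWhile (suc m) (E ʳ++ []) ≡ (suc m , E ʳ++ [])
  buried rewrite ++-ʳ++ C {suc m ∷ z ∷ D} {[]} =
    popWhile-ʳ++ D _ (All>⇒≢ D>m+1) (popWhile-blocked _ (>⇒≢ z>m+1))

  stack : pushAll m [] (C ++ suc m ∷ z ∷ D ++ m ∷ B) ≡ (suc m , B ʳ++ E ʳ++ [])
  stack = begin
    pushAll m [] (C ++ suc m ∷ z ∷ D ++ m ∷ B)       ≡⟨ cong (pushAll m []) (++-assoc C (suc m ∷ z ∷ D) (m ∷ B)) ⟨
    pushAll m [] (E ++ m ∷ B)                        ≡⟨ pushAll-through [] E (m ∷ B) E≢m ⟩
    pushAll m (E ʳ++ []) (m ∷ B)                     ≡⟨ pushAll-min m _ B ⟩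
    uncurry pushAll (popWhile (suc m) (E ʳ++ [])) B  ≡⟨ cong (λ s → uncurry pushAll s B) buried ⟩
    pushAll (suc m) (E ʳ++ []) B                     ≡⟨ pushAll-avoiding _ B (All>⇒≢ B>m+1) ⟩
    (suc m , B ʳ++ E ʳ++ [])                         ∎
    where
    E≢m : All (_≢ m) E
    E≢m = ++⁺ (All>suc⇒≢ C>m+1) (>⇒≢ (n<1+n m) ∷ All>suc⇒≢ zD>m+1)

  unwind : reverse (B ʳ++ E ʳ++ []) ≡ C ++ suc m ∷ z ∷ D ++ B
  unwind = begin
    reverse (B ʳ++ E ʳ++ [])    ≡⟨ cong reverse (++-ʳ++ E) ⟨
    reverse (reverse (E ++ B))  ≡⟨ reverse-involutive (E ++ B) ⟩
    E ++ B                      ≡⟨ ++-assoc C (suc m ∷ z ∷ D) B ⟩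
    C ++ suc m ∷ z ∷ D ++ B     ∎

pass-insert-min-early : ∀ {m i} X Y → All (suc m <_) X → i ≤ suc (length X) →
                        pass (m , insert i m (X ++ suc m ∷ Y)) ≡ pass (suc m , X ++ suc m ∷ Y)
pass-insert-min-early {m} {i} X Y X>m+1 i≤ with i ≤? length X
... | yes i≤X with P , Q , refl , _ , insert≡ ← insert-split m X i≤X = begin
  pass (m , insert i m ((P ++ Q) ++ suc m ∷ Y))  ≡⟨ cong (λ xs → pass (m , xs)) (insert-++ˡ m (P ++ Q) _ i≤X) ⟩
  pass (m , insert i m (P ++ Q) ++ suc m ∷ Y)    ≡⟨ cong (λ xs → pass (m , xs ++ suc m ∷ Y)) insert≡ ⟩
  pass (m , (P ++ m ∷ Q) ++ suc m ∷ Y)           ≡⟨ cong (λ xs → pass (m , xs)) (++-assoc P (m ∷ Q) _) ⟩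
  pass (m , P ++ m ∷ Q ++ suc m ∷ Y)             ≡⟨ pass-remove-min P _ (++⁻ˡ P X>m+1) ⟩
  pass (suc m , P ++ Q ++ suc m ∷ Y)             ≡⟨ cong (λ xs → pass (suc m , xs)) (++-assoc P Q _) ⟨
  pass (suc m , (P ++ Q) ++ suc m ∷ Y)           ∎
... | no i≰X = begin
  pass (m , insert i m (X ++ suc m ∷ Y))               ≡⟨ cong (λ j → pass (m , insert j m (X ++ suc m ∷ Y))) i≡ ⟩
  pass (m , insert (length X + 1) m (X ++ suc m ∷ Y))  ≡⟨ cong (λ xs → pass (m , xs)) (insert-++ʳ 1 m X _) ⟩
  pass (m , X ++ suc m ∷ m ∷ Y)                        ≡⟨ pass-remove-min-after-next X Y X>m+1 ⟩
  pass (suc m , X ++ suc m ∷ Y)                        ∎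
  where
  i≡ : i ≡ length X + 1
  i≡ = trans (≤-antisym i≤ (≰⇒> i≰X)) (+-comm 1 (length X))

+-suc-suc : ∀ a b → a + suc (suc b) ≡ suc (suc (a + b))
+-suc-suc a b = trans (+-suc a (suc b)) (cong suc (+-suc a b))

pass-insert-min-late : ∀ {m i} X Y → All (suc m <_) X → All (suc m <_) Y →
                       suc (suc (length X)) ≤ i → i ≤ length (X ++ suc m ∷ Y) →
                       pass (m , insert i m (X ++ suc m ∷ Y)) ≡ (suc m , X ++ suc m ∷ Y)
pass-insert-min-late X [] _ _ 2+X≤i i≤ =
  ⊥-elim (1+n≰n (subst (suc (suc (length X)) ≤_) (trans (length-++ X) (+-comm (length X) 1)) (≤-trans 2+X≤i i≤)))
pass-insert-min-late {m} X (y ∷ Y) X>m+1 (y>m+1 ∷ Y>m+1) 2+X≤i i≤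
  with j , refl ← m≤n⇒∃[o]m+o≡n 2+X≤i
  with P , Q , refl , _ , insert≡ ← insert-split m Y (+-cancelˡ-≤ (suc (suc (length X))) j (length Y)
         (subst (suc (suc (length X)) + j ≤_) (trans (length-++ X) (+-suc-suc (length X) (length Y))) i≤))
  = begin
  pass (m , insert (suc (suc (length X)) + j) m (X ++ suc m ∷ y ∷ P ++ Q))
    ≡⟨ cong (λ k → pass (m , insert k m (X ++ suc m ∷ y ∷ P ++ Q))) (sym (+-suc-suc (length X) j)) ⟩
  pass (m , insert (length X + suc (suc j)) m (X ++ suc m ∷ y ∷ P ++ Q))
    ≡⟨ cong (λ xs → pass (m , xs)) (insert-++ʳ (suc (suc j)) m X _) ⟩
  pass (m , X ++ suc m ∷ y ∷ insert j m (P ++ Q))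
    ≡⟨ cong (λ xs → pass (m , X ++ suc m ∷ y ∷ xs)) insert≡ ⟩
  pass (m , X ++ suc m ∷ y ∷ P ++ m ∷ Q)
    ≡⟨ pass-next-buried X y P Q X>m+1 (y>m+1 ∷ ++⁻ˡ P Y>m+1) (++⁻ʳ P Y>m+1) ⟩
  (suc m , X ++ suc m ∷ y ∷ P ++ Q)  ∎

-- Passes commute with shifting all values up by one

shift : ℕ × List ℕ → ℕ × List ℕ
shift (m , st) = suc m , map suc st

popWhile-shift : ∀ m st → popWhile (suc m) (map suc st) ≡ shift (popWhile m st)
popWhile-shift m []       = refl
popWhile-shift m (y ∷ st) with y ≡ᵇ m
... | true  = popWhile-shift (suc m) st
... | false = refl

pushAll-shift : ∀ m st xs → pushAll (suc m) (map suc st) (map suc xs) ≡ shift (pushAll m st xs)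
pushAll-shift m st []       = refl
pushAll-shift m st (x ∷ xs) rewrite popWhile-shift m (x ∷ st) with popWhile m (x ∷ st)
... | m′ , st′ = pushAll-shift m′ st′ xs

pass-shift : ∀ s → pass (shift s) ≡ shift (pass s)
pass-shift (m , xs) = begin
  pass (suc m , map suc xs)                       ≡⟨ pass-pushAll (suc m) (map suc xs) ⟩
  map₂ reverse (pushAll (suc m) [] (map suc xs))  ≡⟨ cong (map₂ reverse) (pushAll-shift m [] xs) ⟩
  map₂ reverse (shift (pushAll m [] xs))          ≡⟨ reverse-shift (pushAll m [] xs) ⟩
  shift (map₂ reverse (pushAll m [] xs))          ≡⟨ cong shift (pass-pushAll m xs) ⟨
  shift (pass (m , xs))                           ∎
  where
  reverse-shift : ∀ s → map₂ reverse (shift s) ≡ shift (map₂ reverse s)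
  reverse-shift (m′ , st) = cong (suc m′ ,_) (sym (reverse-map suc st))

passes-shift : ∀ k s → passes k (shift s) ≡ shift (passes k s)
passes-shift zero    s = refl
passes-shift (suc k) s = trans (cong (passes k) (pass-shift s)) (passes-shift k (pass s))

passes-[] : ∀ k m → passes k (m , []) ≡ (m , [])
passes-[] zero    m = refl
passes-[] (suc k) m = passes-[] k m

sortableIn-null : ∀ k π → sortableIn k π ≡ null (proj₂ (passes k (1 , π)))
sortableIn-null k π with proj₂ (passes k (1 , π))
... | []    = refl
... | _ ∷ _ = refl

sortableIn-shift : ∀ k τ → null (proj₂ (passes k (2 , map suc τ))) ≡ sortableIn k τ
sortableIn-shift k τ = begin
  null (proj₂ (passes k (shift (1 , τ))))    ≡⟨ cong (null ∘ proj₂) (passes-shift k (1 , τ)) ⟩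
  null (map suc (proj₂ (passes k (1 , τ))))  ≡⟨ null-map (proj₂ (passes k (1 , τ))) ⟩
  null (proj₂ (passes k (1 , τ)))            ≡⟨ sortableIn-null k τ ⟨
  sortableIn k τ                             ∎
  where
  null-map : ∀ xs → null (map suc xs) ≡ null xs
  null-map []      = refl
  null-map (_ ∷ _) = refl

sortableIn-shifted-pass : ∀ k π τ → null π ≡ null τ → pass (1 , π) ≡ pass (2 , map suc τ) →
                          sortableIn k π ≡ sortableIn k τ
sortableIn-shifted-pass zero    π τ null≡ _ = trans (sortableIn-null 0 π) (trans null≡ (sym (sortableIn-null 0 τ)))
sortableIn-shifted-pass (suc k) π τ _ pass≡ = begin
  sortableIn (suc k) π                           ≡⟨ sortableIn-null (suc k) π ⟩
  null (proj₂ (passes k (pass (1 , π))))         ≡⟨ cong (λ s → null (proj₂ (passes k s))) pass≡ ⟩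
  null (proj₂ (passes (suc k) (2 , map suc τ)))  ≡⟨ sortableIn-shift (suc k) τ ⟩
  sortableIn (suc k) τ                           ∎

sortableIn-shifted-remainder : ∀ k π τ → pass (1 , π) ≡ (2 , map suc τ) → sortableIn (suc k) π ≡ sortableIn k τ
sortableIn-shifted-remainder k π τ pass≡ = begin
  sortableIn (suc k) π                     ≡⟨ sortableIn-null (suc k) π ⟩
  null (proj₂ (passes k (pass (1 , π))))   ≡⟨ cong (λ s → null (proj₂ (passes k s))) pass≡ ⟩
  null (proj₂ (passes k (2 , map suc τ)))  ≡⟨ sortableIn-shift k τ ⟩
  sortableIn k τ                           ∎

module _ (X Y : List ℕ) where

  map-suc-split : map suc (X ++ 1 ∷ Y) ≡ map suc X ++ 2 ∷ map suc Y
  map-suc-split = map-++ suc X (1 ∷ Y)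

  sortableIn-insert-early : ∀ k {i} τ → τ ≡ X ++ 1 ∷ Y → All (1 <_) X → i ≤ suc (length X) →
                            sortableIn k (insert i 1 (map suc τ)) ≡ sortableIn k τ
  sortableIn-insert-early k {i} _ refl X>1 i≤ =
    sortableIn-shifted-pass k (insert i 1 (map suc (X ++ 1 ∷ Y))) (X ++ 1 ∷ Y)
      (trans (null-insert i 1 _) (sym (null-++-∷ X 1 Y))) (begin
      pass (1 , insert i 1 (map suc (X ++ 1 ∷ Y)))        ≡⟨ cong (λ xs → pass (1 , insert i 1 xs)) map-suc-split ⟩
      pass (1 , insert i 1 (map suc X ++ 2 ∷ map suc Y))
        ≡⟨ pass-insert-min-early (map suc X) _ (map-suc-above X X>1)
             (subst (λ n → i ≤ suc n) (sym (length-map suc X)) i≤) ⟩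
      pass (2 , map suc X ++ 2 ∷ map suc Y)               ≡⟨ cong (λ xs → pass (2 , xs)) map-suc-split ⟨
      pass (2 , map suc (X ++ 1 ∷ Y))                     ∎)

  sortableIn-insert-late : ∀ k {i} τ → τ ≡ X ++ 1 ∷ Y → All (1 <_) X → All (1 <_) Y →
                           suc (suc (length X)) ≤ i → i ≤ length τ →
                           sortableIn (suc k) (insert i 1 (map suc τ)) ≡ sortableIn k τ
  sortableIn-insert-late k {i} _ refl X>1 Y>1 2+X≤i i≤ =
    sortableIn-shifted-remainder k (insert i 1 (map suc (X ++ 1 ∷ Y))) (X ++ 1 ∷ Y) (begin
      pass (1 , insert i 1 (map suc (X ++ 1 ∷ Y)))        ≡⟨ cong (λ xs → pass (1 , insert i 1 xs)) map-suc-split ⟩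
      pass (1 , insert i 1 (map suc X ++ 2 ∷ map suc Y))
        ≡⟨ pass-insert-min-late (map suc X) _ (map-suc-above X X>1) (map-suc-above Y Y>1) 2+sX≤i i≤sτ ⟩
      (2 , map suc X ++ 2 ∷ map suc Y)                    ≡⟨ cong (2 ,_) map-suc-split ⟨
      (2 , map suc (X ++ 1 ∷ Y))                          ∎)
    where
    2+sX≤i : suc (suc (length (map suc X))) ≤ i
    2+sX≤i = subst (λ n → suc (suc n) ≤ i) (sym (length-map suc X)) 2+X≤i
    i≤sτ : i ≤ length (map suc X ++ 2 ∷ map suc Y)
    i≤sτ = subst (i ≤_) (trans (sym (length-map suc (X ++ 1 ∷ Y))) (cong length map-suc-split)) i≤

-- Encoding permutations by bounded sequences

InRange : ℕ → ℕ → Set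
InRange b x = 1 ≤ x × x ≤ b

data Bounded : List ℕ → Set where
  []  : Bounded []
  _∷_ : ∀ {ℓ a} → InRange (suc (length a)) ℓ → Bounded a → Bounded (ℓ ∷ a)

toPerm : List ℕ → List ℕ
toPerm []      = []
toPerm (ℓ ∷ a) = insert (suc (length a) ∸ ℓ) 1 (map suc (toPerm a))

length-toPerm : ∀ a → length (toPerm a) ≡ length a
length-toPerm []      = refl
length-toPerm (ℓ ∷ a) = begin
  length (toPerm (ℓ ∷ a))            ≡⟨ length-insert (suc (length a) ∸ ℓ) 1 (map suc (toPerm a)) ⟩
  suc (length (map suc (toPerm a)))  ≡⟨ cong suc (length-map suc (toPerm a)) ⟩
  suc (length (toPerm a))            ≡⟨ cong suc (length-toPerm a) ⟩
  suc (length a)                     ∎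

toPerm-nonempty : ∀ ℓ a → null (toPerm (ℓ ∷ a)) ≡ false
toPerm-nonempty ℓ a = null-insert _ 1 _

toPerm-inRange : ∀ a → All (InRange (length a)) (toPerm a)
toPerm-inRange []      = []
toPerm-inRange (ℓ ∷ a) =
  All-insert _ 1 _ (s≤s z≤n , s≤s z≤n) (All.map⁺ (All.map (λ (_ , x≤) → s≤s z≤n , s≤s x≤) (toPerm-inRange a)))

toPerm-complete : ∀ a {v} → InRange (length a) v → v ∈ toPerm a
toPerm-complete (ℓ ∷ a) {suc zero}    _            = ∈-insert _ 1 (map suc (toPerm a))
toPerm-complete (ℓ ∷ a) {suc (suc v)} (_ , s≤s v<) =
  ∈-insert⁺ _ 1 (map suc (toPerm a)) (∈-map⁺ suc (toPerm-complete a (s≤s z≤n , v<)))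

map-suc-toPerm>1 : ∀ a → All (1 <_) (map suc (toPerm a))
map-suc-toPerm>1 a = map-suc-above (toPerm a) (All.map proj₁ (toPerm-inRange a))

toPerm-index≤ : ∀ ℓ a → 1 ≤ ℓ → suc (length a) ∸ ℓ ≤ length (map suc (toPerm a))
toPerm-index≤ (suc r) a _ =
  subst (length a ∸ r ≤_) (sym (trans (length-map suc (toPerm a)) (length-toPerm a))) (m∸n≤m (length a) r)

toPerm-split : ∀ ℓ a → 1 ≤ ℓ → ∃₂ λ X Y → toPerm (ℓ ∷ a) ≡ X ++ 1 ∷ Y × length X ≡ suc (length a) ∸ ℓ ×
                                          All (1 <_) X × All (1 <_) Y
toPerm-split ℓ a 1≤ℓ with X , Y , split , length-X , eq ← insert-split 1 (map suc (toPerm a)) (toPerm-index≤ ℓ a 1≤ℓ) =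
  X , Y , eq , length-X , ++⁻ˡ X XY>1 , ++⁻ʳ X XY>1
  where
  XY>1 : All (1 <_) (X ++ Y)
  XY>1 = subst (All (1 <_)) split (map-suc-toPerm>1 a)

insert-early-bound : ∀ {L ℓ ℓ′} → ℓ ≤ suc L → ℓ ≤ ℓ′ → suc (suc L) ∸ ℓ′ ≤ suc (suc L ∸ ℓ)
insert-early-bound {L} ℓ≤ ℓ≤ℓ′ = ≤-trans (∸-monoʳ-≤ (suc (suc L)) ℓ≤ℓ′) (≤-reflexive (+-∸-assoc 1 ℓ≤))

insert-late-bound : ∀ {L ℓ ℓ′} → ℓ ≤ suc L → ℓ′ < ℓ → suc (suc (suc L ∸ ℓ)) ≤ suc (suc L) ∸ ℓ′
insert-late-bound {L} {suc r} (s≤s r≤L) (s≤s ℓ′≤r) =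
  ≤-trans (≤-reflexive (sym (+-∸-assoc 2 r≤L))) (∸-monoʳ-≤ (suc (suc L)) ℓ′≤r)

insert-late-bound-upper : ∀ {L ℓ′} → 1 ≤ ℓ′ → suc (suc L) ∸ ℓ′ ≤ suc L
insert-late-bound-upper {L} {suc r} _ = m∸n≤m (suc L) r

sortableIn-toPerm : ∀ k ℓ a → Bounded (ℓ ∷ a) → sortableIn k (toPerm (ℓ ∷ a)) ≡ (ascents (ℓ ∷ a) <ᵇ k)
sortableIn-toPerm zero    .1 [] ((s≤s z≤n , s≤s z≤n) ∷ []) = refl
sortableIn-toPerm (suc k) .1 [] ((s≤s z≤n , s≤s z≤n) ∷ []) =
  trans (sortableIn-null (suc k) (1 ∷ [])) (cong (null ∘ proj₂) (passes-[] k 2))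
sortableIn-toPerm k ℓ′ (ℓ ∷ a) ((1≤ℓ′ , _) ∷ bounded@((1≤ℓ , ℓ≤) ∷ _))
  with X , Y , τ≡ , length-X , X>1 , Y>1 ← toPerm-split ℓ a 1≤ℓ
  with ℓ′ <ᵇ ℓ in ℓ′<ᵇℓ
... | false = trans (sortableIn-insert-early X Y k _ τ≡ X>1 i≤) (sortableIn-toPerm k ℓ a bounded)
  where
  i≤ : suc (suc (length a)) ∸ ℓ′ ≤ suc (length X)
  i≤ = subst (λ n → _ ≤ suc n) (sym length-X) (insert-early-bound ℓ≤ (≮⇒≥ (subst IsTrue ℓ′<ᵇℓ ∘ <⇒<ᵇ)))
... | true = extra-pass k
  where
  i = suc (suc (length a)) ∸ ℓ′

  2+X≤i : suc (suc (length X)) ≤ i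
  2+X≤i = subst (λ n → suc (suc n) ≤ i) (sym length-X) (insert-late-bound ℓ≤ (<ᵇ⇒< ℓ′ ℓ (subst IsTrue (sym ℓ′<ᵇℓ) _)))

  i≤ : i ≤ length (toPerm (ℓ ∷ a))
  i≤ = subst (i ≤_) (sym (length-toPerm (ℓ ∷ a))) (insert-late-bound-upper 1≤ℓ′)

  extra-pass : ∀ k → sortableIn k (insert i 1 (map suc (toPerm (ℓ ∷ a)))) ≡ (suc (ascents (ℓ ∷ a)) <ᵇ k)
  extra-pass zero    = trans (sortableIn-null 0 _) (null-insert i 1 _)
  extra-pass (suc k) = trans (sortableIn-insert-late X Y k _ τ≡ X>1 Y>1 2+X≤i i≤) (sortableIn-toPerm k ℓ a bounded)

∈-range1⁺ : ∀ {b x} → InRange b x → x ∈ range1 b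
∈-range1⁺ {x = suc y} (_ , y<b) = ∈-map⁺ suc (∈-upTo⁺ y<b)

∈-range1⁻ : ∀ {b x} → x ∈ range1 b → InRange b x
∈-range1⁻ x∈ with _ , y∈ , refl ← ∈-map⁻ suc x∈ = s≤s z≤n , ∈-upTo⁻ y∈

concatMap-cons : ∀ {A : Set} (xs : List A) (S : List (List A)) →
                 concatMap (λ x → map (x ∷_) S) xs ≡ cartesianProductWith _∷_ xs S
concatMap-cons []       S = refl
concatMap-cons (x ∷ xs) S = cong (map (x ∷_) S ++_) (concatMap-cons xs S)

seqs-suc : ∀ n b → seqs (suc n) b ≡ cartesianProductWith _∷_ (range1 b) (seqs n b)
seqs-suc n b = concatMap-cons (range1 b) (seqs n b)

∈-seqs⁺ : ∀ {b} l → All (InRange b) l → l ∈ seqs (length l) b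
∈-seqs⁺     []      []          = here refl
∈-seqs⁺ {b} (x ∷ l) (x∈ ∷ l-in) rewrite seqs-suc (length l) b =
  ∈-cartesianProductWith⁺ _∷_ (∈-range1⁺ x∈) (∈-seqs⁺ l l-in)

∈-seqs⁻ : ∀ n b {l} → l ∈ seqs n b → length l ≡ n × All (InRange b) l
∈-seqs⁻ zero    b (here refl) = refl , []
∈-seqs⁻ (suc n) b l∈ rewrite seqs-suc n b
  with _ , l′ , x∈ , l′∈ , refl ← ∈-cartesianProductWith⁻ _∷_ (range1 b) (seqs n b) l∈
  with refl , l′-in ← ∈-seqs⁻ n b l′∈ = refl , ∈-range1⁻ x∈ ∷ l′-in

seqs-unique : ∀ n b → Unique (seqs n b)
seqs-unique zero    b = [] AllPairs.∷ AllPairs.[]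
seqs-unique (suc n) b rewrite seqs-suc n b =
  Unique.cartesianProductWith⁺ _∷_ ∷-injective (Unique.map⁺ suc-injective (Unique.upTo⁺ b)) (seqs-unique n b)

record IsPermutation (n : ℕ) (π : List ℕ) : Set where
  field
    length≡  : length π ≡ n
    inRange  : All (InRange n) π
    complete : ∀ {v} → InRange n v → v ∈ π

containsAll⁺ : ∀ n l → (∀ {v} → InRange n v → v ∈ l) → IsTrue (containsAll n l)
containsAll⁺ n l complete =
  All.all⁻ _ (All.tabulate λ v∈ → Any.any⁺ _ (Any.map (≡⇒≡ᵇ _ _) (complete (∈-range1⁻ v∈))))

containsAll⁻ : ∀ n l → IsTrue (containsAll n l) → ∀ {v} → InRange n v → v ∈ l
containsAll⁻ n l contains v-in =
  Any.map (≡ᵇ⇒≡ _ _) (Any.any⁻ _ l (All.lookup (All.all⁺ _ (range1 n) contains) (∈-range1⁺ v-in)))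

∈-perms⁺ : ∀ {n π} → IsPermutation n π → π ∈ perms n
∈-perms⁺ {n} {π} perm = ∈-filter⁺ (IsTrue? ∘ containsAll n)
  (subst (λ m → π ∈ seqs m n) length≡ (∈-seqs⁺ π inRange)) (containsAll⁺ n π complete)
  where open IsPermutation perm

∈-perms⁻ : ∀ {n π} → π ∈ perms n → IsPermutation n π
∈-perms⁻ {n} {π} π∈
  with π∈seqs , contains ← ∈-filter⁻ (IsTrue? ∘ containsAll n) {xs = seqs n n} π∈
  with length≡ , inRange ← ∈-seqs⁻ n n π∈seqs =
  record { length≡ = length≡ ; inRange = inRange ; complete = containsAll⁻ n π contains }

Bounded⇒inRange : ∀ {a} → Bounded a → All (InRange (length a)) a
Bounded⇒inRange []               = []
Bounded⇒inRange (ℓ-in ∷ bounded) = ℓ-in ∷ All.map (λ (1≤x , x≤) → 1≤x , m≤n⇒m≤1+n x≤) (Bounded⇒inRange bounded)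

boundedFrom⇒Bounded : ∀ a → IsTrue (boundedFrom (length a) a) → Bounded a
boundedFrom⇒Bounded []      _ = []
boundedFrom⇒Bounded (ℓ ∷ a) t
  with 1≤ℓ , t′ ← Equivalence.to T-∧ t
  with ℓ≤ , t″ ← Equivalence.to T-∧ t′ = (≤ᵇ⇒≤ 1 ℓ 1≤ℓ , ≤ᵇ⇒≤ ℓ _ ℓ≤) ∷ boundedFrom⇒Bounded a t″

Bounded⇒boundedFrom : ∀ {a} → Bounded a → IsTrue (boundedFrom (length a) a)
Bounded⇒boundedFrom []                     = _
Bounded⇒boundedFrom ((1≤ℓ , ℓ≤) ∷ bounded) =
  Equivalence.from T-∧ (≤⇒≤ᵇ 1≤ℓ , Equivalence.from T-∧ (≤⇒≤ᵇ ℓ≤ , Bounded⇒boundedFrom bounded))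

boundedSeqs : ℕ → List (List ℕ)
boundedSeqs n = filterᵇ (boundedFrom n) (seqs n n)

∈-boundedSeqs⁺ : ∀ {a} → Bounded a → a ∈ boundedSeqs (length a)
∈-boundedSeqs⁺ {a} bounded =
  ∈-filter⁺ (IsTrue? ∘ boundedFrom (length a)) (∈-seqs⁺ a (Bounded⇒inRange bounded)) (Bounded⇒boundedFrom bounded)

∈-boundedSeqs⁻ : ∀ {n a} → a ∈ boundedSeqs n → Bounded a × length a ≡ n
∈-boundedSeqs⁻ {n} {a} a∈
  with a∈seqs , t ← ∈-filter⁻ (IsTrue? ∘ boundedFrom n) {xs = seqs n n} a∈
  with refl , _ ← ∈-seqs⁻ n n a∈seqs = boundedFrom⇒Bounded a t , refl

-- The encoding is a bijection

toPerm-isPermutation : ∀ a → IsPermutation (length a) (toPerm a)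
toPerm-isPermutation a = record { length≡ = length-toPerm a ; inRange = toPerm-inRange a ; complete = toPerm-complete a }

toPerm-injective : ∀ {a b} → Bounded a → Bounded b → toPerm a ≡ toPerm b → a ≡ b
toPerm-injective []          []      _  = refl
toPerm-injective {b = ℓ ∷ b} []      (_ ∷ _) eq with () ← trans (cong null eq) (toPerm-nonempty ℓ b)
toPerm-injective {a = ℓ ∷ a} (_ ∷ _) []      eq with () ← trans (cong null (sym eq)) (toPerm-nonempty ℓ a)
toPerm-injective {ℓ ∷ a} {ℓ′ ∷ b} ((1≤ℓ , ℓ≤) ∷ bounded-a) ((1≤ℓ′ , ℓ′≤) ∷ bounded-b) eq
  with index≡ , shifted≡ ← insert-injective {x = 1} (suc (length a) ∸ ℓ) (suc (length b) ∸ ℓ′)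
         (map suc (toPerm a)) (map suc (toPerm b)) (All>⇒≢ (map-suc-toPerm>1 a)) (All>⇒≢ (map-suc-toPerm>1 b))
         (toPerm-index≤ ℓ a 1≤ℓ) (toPerm-index≤ ℓ′ b 1≤ℓ′) eq
  with refl ← toPerm-injective bounded-a bounded-b (map-injective {f = suc} suc-injective shifted≡)
  = cong (_∷ a) (∸-cancelˡ-≡ ℓ≤ ℓ′≤ index≡)

IsPermutation-remove-min : ∀ {n} A B → IsPermutation (suc n) (A ++ 1 ∷ B) →
                           ∃ λ τ → IsPermutation n τ × map suc τ ≡ A ++ B
IsPermutation-remove-min {n} A B perm = map pred L , τ-perm , suc-pred
  where
  open IsPermutation perm
  L = A ++ B
  U = map suc (range1 n)

  L≡ : length L ≡ n
  L≡ = suc-injective (trans (sym (↭-length (↭-shift 1 A B))) length≡)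

  U≡ : length U ≡ n
  U≡ = trans (length-map suc (range1 n)) (trans (length-map suc (upTo n)) (length-upTo n))

  U-unique : Unique U
  U-unique = Unique.map⁺ suc-injective (Unique.map⁺ suc-injective (Unique.upTo⁺ n))

  U⊆L : U ⊆ L
  U⊆L w∈U with v , v∈ , refl ← ∈-map⁻ suc w∈U
    with ∈-resp-↭ (↭-shift 1 A B) (complete (s≤s z≤n , s≤s (proj₂ (∈-range1⁻ v∈))))
  ... | here v+1≡1 = ⊥-elim (1+n≰n (subst (1 ≤_) (suc-injective v+1≡1) (proj₁ (∈-range1⁻ v∈))))
  ... | there w∈L  = w∈L

  -- Pigeonhole: L has n entries and contains the n distinct values 2, …, n + 1, so no others.
  L-shifted : ∀ {z} → z ∈ L → ∃ λ v → z ≡ suc v × InRange n v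
  L-shifted z∈L
    with v , v∈ , refl ← ∈-map⁻ suc (unique∧⊆∧length≤⇒⊇ U-unique U⊆L (≤-reflexive (trans L≡ (sym U≡))) z∈L)
    = v , refl , ∈-range1⁻ v∈

  suc-pred : map suc (map pred L) ≡ L
  suc-pred = trans (sym (map-∘ L)) (map-id-local (All.tabulate λ z∈L → shape (L-shifted z∈L)))
    where
    shape : ∀ {z} → (∃ λ v → z ≡ suc v × InRange n v) → suc (pred z) ≡ z
    shape (_ , refl , _) = refl

  τ-perm : IsPermutation n (map pred L)
  τ-perm = record
    { length≡  = trans (length-map pred L) L≡
    ; inRange  = All.map⁺ (All.tabulate λ z∈L → shape (L-shifted z∈L))
    ; complete = λ v-in → ∈-map⁺ pred (U⊆L (∈-map⁺ suc (∈-range1⁺ v-in)))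
    }
    where
    shape : ∀ {z} → (∃ λ v → z ≡ suc v × InRange n v) → InRange n (pred z)
    shape (_ , refl , v-in) = v-in

toPerm-surjective : ∀ n {π} → IsPermutation n π → ∃ λ a → Bounded a × length a ≡ n × toPerm a ≡ π
toPerm-surjective zero    {[]}    _    = [] , [] , refl , refl
toPerm-surjective zero    {_ ∷ _} perm with () ← IsPermutation.length≡ perm
toPerm-surjective (suc n) {π}     perm
  with A , B , refl ← ∈-∃++ (IsPermutation.complete perm (s≤s z≤n , s≤s z≤n))
  with τ , τ-perm , suc-τ ← IsPermutation-remove-min A B perm
  with a , bounded , refl , toPerm-a ← toPerm-surjective n τ-perm
  = (suc (length a) ∸ length A) ∷ a , (1≤ℓ , m∸n≤m (suc (length a)) (length A)) ∷ bounded , refl , (begin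
      insert (suc (length a) ∸ (suc (length a) ∸ length A)) 1 (map suc (toPerm a))
        ≡⟨ cong₂ (λ i xs → insert i 1 xs) (m∸[m∸n]≡n (m≤n⇒m≤1+n A≤)) (trans (cong (map suc) toPerm-a) suc-τ) ⟩
      insert (length A) 1 (A ++ B)  ≡⟨ insert-length 1 A B ⟩
      A ++ 1 ∷ B                    ∎)
  where
  A≤ : length A ≤ length a
  A≤ = subst (length A ≤_) (trans (cong length (sym suc-τ)) (trans (length-map suc τ) (IsPermutation.length≡ τ-perm)))
         (length-++-≤ˡ A)
  1≤ℓ : 1 ≤ suc (length a) ∸ length A
  1≤ℓ = subst (1 ≤_) (sym (+-∸-assoc 1 A≤)) (s≤s z≤n)

perms↭toPerm[boundedSeqs] : ∀ n → perms n ↭ map toPerm (boundedSeqs n)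
perms↭toPerm[boundedSeqs] n = ∼bag⇒↭ (unique∧set⇒bag perms-unique image-unique (mk⇔ to from))
  where
  perms-unique : Unique (perms n)
  perms-unique = Unique.filter⁺ (IsTrue? ∘ containsAll n) (seqs-unique n n)

  image-unique : Unique (map toPerm (boundedSeqs n))
  image-unique = map-unique (λ a∈ b∈ → toPerm-injective (proj₁ (∈-boundedSeqs⁻ {n} a∈)) (proj₁ (∈-boundedSeqs⁻ {n} b∈)))
                   (Unique.filter⁺ (IsTrue? ∘ boundedFrom n) (seqs-unique n n))

  to : ∀ {π} → π ∈ perms n → π ∈ map toPerm (boundedSeqs n)
  to π∈ with a , bounded , refl , refl ← toPerm-surjective n (∈-perms⁻ π∈) = ∈-map⁺ toPerm (∈-boundedSeqs⁺ bounded)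

  from : ∀ {π} → π ∈ map toPerm (boundedSeqs n) → π ∈ perms n
  from π∈ with a , a∈ , refl ← ∈-map⁻ toPerm π∈ =
    ∈-perms⁺ (subst (λ m → IsPermutation m (toPerm a)) (proj₂ (∈-boundedSeqs⁻ {n} a∈)) (toPerm-isPermutation a))

count : {A : Set} → (A → Bool) → List A → ℕ
count p xs = length (filterᵇ p xs)

module _ {A : Set} where

  count-↭ : ∀ (p : A → Bool) {xs ys} → xs ↭ ys → count p xs ≡ count p ys
  count-↭ p xs↭ys = ↭-length (filter-↭ (IsTrue? ∘ p) xs↭ys)

  count-map : ∀ {B : Set} (p : B → Bool) (f : A → B) xs → count p (map f xs) ≡ count (p ∘ f) xs
  count-map p f []       = refl
  count-map p f (x ∷ xs) with p (f x)
  ... | true  = cong suc (count-map p f xs)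
  ... | false = count-map p f xs

  count-cong : ∀ {p q : A → Bool} {xs} → All (λ x → p x ≡ q x) xs → count p xs ≡ count q xs
  count-cong                  []            = refl
  count-cong {p} {q} {x ∷ xs} (px≡qx ∷ eqs) rewrite px≡qx with q x
  ... | true  = cong suc (count-cong eqs)
  ... | false = count-cong eqs

  count-false : ∀ xs → count (λ (_ : A) → false) xs ≡ 0
  count-false []       = refl
  count-false (_ ∷ xs) = count-false xs

  count-∧ : ∀ (p q : A → Bool) xs → count (λ x → p x ∧ q x) xs ≡ count q (filterᵇ p xs)
  count-∧ p q []       = refl
  count-∧ p q (x ∷ xs) with p x
  ... | false = count-∧ p q xs
  ... | true with q x
  ...   | true  = cong suc (count-∧ p q xs)
  ...   | false = count-∧ p q xs

  count-∨ : ∀ (p q : A → Bool) xs → (∀ x → (p x ∧ q x) ≡ false) →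
            count (λ x → p x ∨ q x) xs ≡ count p xs + count q xs
  count-∨ p q []       _        = refl
  count-∨ p q (x ∷ xs) disjoint with p x | q x | disjoint x
  ... | true  | false | _ = cong suc (count-∨ p q xs disjoint)
  ... | false | true  | _ = trans (cong suc (count-∨ p q xs disjoint)) (sym (+-suc (count p xs) (count q xs)))
  ... | false | false | _ = count-∨ p q xs disjoint

<ᵇ-suc : ∀ m k → (m <ᵇ suc k) ≡ (m <ᵇ k) ∨ (m ≡ᵇ k)
<ᵇ-suc zero    zero    = refl
<ᵇ-suc zero    (suc k) = refl
<ᵇ-suc (suc m) zero    = refl
<ᵇ-suc (suc m) (suc k) = <ᵇ-suc m k

<ᵇ∧≡ᵇ : ∀ m k → ((m <ᵇ k) ∧ (m ≡ᵇ k)) ≡ false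
<ᵇ∧≡ᵇ zero    zero    = refl
<ᵇ∧≡ᵇ zero    (suc k) = refl
<ᵇ∧≡ᵇ (suc m) zero    = refl
<ᵇ∧≡ᵇ (suc m) (suc k) = <ᵇ∧≡ᵇ m k

sum-upTo-suc : ∀ (F : ℕ → ℕ) k → sum (map F (upTo (suc k))) ≡ sum (map F (upTo k)) + F k
sum-upTo-suc F k = begin
  sum (map F (upTo (suc k)))        ≡⟨ cong (sum ∘ map F) (upTo-∷ʳ k) ⟨
  sum (map F (upTo k ++ [ k ]))     ≡⟨ cong sum (map-++ F (upTo k) [ k ]) ⟩
  sum (map F (upTo k) ++ [ F k ])   ≡⟨ sum-++ (map F (upTo k)) [ F k ] ⟩
  sum (map F (upTo k)) + (F k + 0)  ≡⟨ cong (sum (map F (upTo k)) +_) (+-identityʳ (F k)) ⟩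
  sum (map F (upTo k)) + F k        ∎

count-<ᵇ : ∀ {A : Set} (g : A → ℕ) k xs →
           count (λ x → g x <ᵇ k) xs ≡ sum (map (λ j → count (λ x → g x ≡ᵇ j) xs) (upTo k))
count-<ᵇ g zero    xs = count-false xs
count-<ᵇ g (suc k) xs = begin
  count (λ x → g x <ᵇ suc k) xs                          ≡⟨ count-cong {xs = xs} (All.tabulate λ {x} _ → <ᵇ-suc (g x) k) ⟩
  count (λ x → (g x <ᵇ k) ∨ (g x ≡ᵇ k)) xs               ≡⟨ count-∨ _ _ xs (λ x → <ᵇ∧≡ᵇ (g x) k) ⟩
  count (λ x → g x <ᵇ k) xs + count (λ x → g x ≡ᵇ k) xs  ≡⟨ cong (_+ F k) (count-<ᵇ g k xs) ⟩
  sum (map F (upTo k)) + F k                             ≡⟨ sum-upTo-suc F k ⟨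
  sum (map F (upTo (suc k)))                             ∎
  where
  F = λ j → count (λ x → g x ≡ᵇ j) xs

sortableIn-toPerm-boundedSeqs : ∀ {n} k → 1 ≤ n → All (λ a → sortableIn k (toPerm a) ≡ (ascents a <ᵇ k)) (boundedSeqs n)
sortableIn-toPerm-boundedSeqs {n} k 1≤n = All.tabulate λ a∈ → sortable (∈-boundedSeqs⁻ {n} a∈)
  where
  sortable : ∀ {a} → Bounded a × length a ≡ n → sortableIn k (toPerm a) ≡ (ascents a <ᵇ k)
  sortable {[]}    (_ , refl)    = ⊥-elim (1+n≰n 1≤n)
  sortable {ℓ ∷ a} (bounded , _) = sortableIn-toPerm k ℓ a bounded

corollary4p7 : (n k : ℕ) → 1 ≤ n → 1 ≤ k →
    numSortable n k ≡ sum (map (T n) (upTo k))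
corollary4p7 n k 1≤n _ = begin
  count (sortableIn k) (perms n)                     ≡⟨ count-↭ (sortableIn k) (perms↭toPerm[boundedSeqs] n) ⟩
  count (sortableIn k) (map toPerm (boundedSeqs n))  ≡⟨ count-map (sortableIn k) toPerm (boundedSeqs n) ⟩
  count (sortableIn k ∘ toPerm) (boundedSeqs n)      ≡⟨ count-cong (sortableIn-toPerm-boundedSeqs k 1≤n) ⟩
  count (λ a → ascents a <ᵇ k) (boundedSeqs n)       ≡⟨ count-<ᵇ ascents k (boundedSeqs n) ⟩
  sum (map (λ j → count (λ a → ascents a ≡ᵇ j) (boundedSeqs n)) (upTo k))
    ≡⟨ cong sum (map-cong (λ j → sym (count-∧ (boundedFrom n) (λ a → ascents a ≡ᵇ j) (seqs n n))) (upTo k)) ⟩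
  sum (map (T n) (upTo k))                           ∎
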